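{- Let $G$ be a graph with $4\le |V(G)|\le 5$ and $E(G)\ne\emptyset$. Then $\varphi_r(G-v)=\varphi_r(G)+\lfloor |V(G)|/2\rfloor-2$ for every vertex $v\in V(G)$ if and only if $G$ contains two disjoint edges but contains no induced subgraph isomorphic to a minimal b-$3$-atom.
   Context: A proper $k$-coloring of a graph is a surjective map $c:V\to\{1,\dots,k\}$ with $c(u)\ne c(v)$ for every edge $uv$. In a proper $k$-coloring, a vertex $v$ of color $i$ is a b-vertex if for every $j\ne i$ in $\{1,\dots,k\}$, $v$ has a neighbor of color $j$. A b-$k$-coloring is a proper $k$-coloring in which every color class contains a b-vertex; $\varphi(H)$ is the largest $k$ such that $H$ has a b-$k$-coloring, and $\varphi_r(G)=\max\{\varphi(H): H\text{ an induced subgraph of }G\}$. A b-$t$-atom is a graph $A$ whose vertex set can be partitioned into $t$ sets $D_1,\dots,D_t$, where each $D_i$ contains a special vertex $c_i$, such that each $D_i$ is an independent set with $|D_i|\le t$, and for all $i\ne j$, $c_i$ has a neighbor in $D_j$. A b-$t$-atom is minimal if no b-$t$-atom is a proper induced subgraph of it. Two edges are disjoint if they share no endpoint. -}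

module Defs where

open import Data.Nat using (ℕ; zero; suc; pred; _<_; _≤_)
open import Data.Fin using (Fin; punchIn) renaming (_≟_ to _≟ᶠ_)
open import Data.Bool using (Bool; true; false)
open import Data.List using (List; length; filter; allFin)
open import Data.Product using (Σ; ∃; ∃-syntax; _×_; _,_)
open import Relation.Nullary using (¬_)
open import Relation.Binary.PropositionalEquality using (_≡_; _≢_)
open import Function.Definitions using (Injective)

record Graph (n : ℕ) : Set where
  field
    adj    : Fin n → Fin n → Bool
    sym    : ∀ u v → adj u v ≡ adj v u
    irrefl : ∀ u → adj u u ≡ false
open Graph public

Adj : ∀ {n} → Graph n → Fin n → Fin n → Set
Adj G u v = adj G u v ≡ true

induced : ∀ {m n} → Graph n → (Fin m → Fin n) → Graph m
induced G f = record
  { adj    = λ i j → adj G (f i) (f j)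
  ; sym    = λ i j → sym G (f i) (f j)
  ; irrefl = λ i → irrefl G (f i)
  }

-- G - v : delete vertex v (vertices of G - v are Fin (n-1), embedded by punchIn v).
delete : ∀ {n} → Graph n → Fin n → Graph (pred n)
delete {suc n} G v = induced G (punchIn v)

IsProperColoring : ∀ {m} → Graph m → (k : ℕ) → (Fin m → Fin k) → Set
IsProperColoring {m} H k c =
  (∀ (i : Fin k) → ∃[ u ] c u ≡ i) ×
  (∀ u v → Adj H u v → c u ≢ c v)

IsBVertex : ∀ {m} → Graph m → (k : ℕ) → (Fin m → Fin k) → Fin m → Set
IsBVertex H k c v = ∀ (j : Fin k) → j ≢ c v → ∃[ u ] (Adj H v u × c u ≡ j)

IsBColoring : ∀ {m} → Graph m → (k : ℕ) → (Fin m → Fin k) → Set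
IsBColoring {m} H k c =
  IsProperColoring H k c ×
  (∀ (i : Fin k) → ∃[ v ] (c v ≡ i × IsBVertex H k c v))

HasBColoring : ∀ {m} → Graph m → ℕ → Set
HasBColoring {m} H k = ∃[ c ] IsBColoring H k c

-- r is φ_r(G): the maximum of φ(H) over induced subgraphs H of G, i.e.
-- the largest k such that some induced subgraph of G has a b-k-coloring.
IsPhiR : ∀ {n} → Graph n → ℕ → Set
IsPhiR {n} G r =
  (∃[ m ] Σ (Fin m → Fin n) λ f → Injective _≡_ _≡_ f × HasBColoring (induced G f) r) ×
  (∀ m (f : Fin m → Fin n) → Injective _≡_ _≡_ f → ∀ k → HasBColoring (induced G f) k → k ≤ r)

classSize : ∀ {m t} → (Fin m → Fin t) → Fin t → ℕ
classSize {m} d i = length (filter (λ u → d u ≟ᶠ i) (allFin m))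

IsBAtom : ∀ {m} → Graph m → ℕ → Set
IsBAtom {m} A t =
  Σ (Fin m → Fin t) λ d → Σ (Fin t → Fin m) λ c →
    (∀ i → d (c i) ≡ i) ×
    (∀ u v → Adj A u v → d u ≢ d v) ×
    (∀ i → classSize d i ≤ t) ×
    (∀ i j → i ≢ j → ∃[ u ] (d u ≡ j × Adj A (c i) u))

IsMinimalBAtom : ∀ {m} → Graph m → ℕ → Set
IsMinimalBAtom {m} A t =
  IsBAtom A t ×
  (∀ m' (f : Fin m' → Fin m) → Injective _≡_ _≡_ f → m' < m → ¬ IsBAtom (induced A f) t)

ContainsMinimalBAtom : ∀ {n} → Graph n → ℕ → Set
ContainsMinimalBAtom {n} G t =
  ∃[ m ] Σ (Fin m → Fin n) λ f → Injective _≡_ _≡_ f × IsMinimalBAtom (induced G f) t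

HasEdge : ∀ {n} → Graph n → Set
HasEdge G = ∃[ u ] ∃[ v ] Adj G u v

HasTwoDisjointEdges : ∀ {n} → Graph n → Set
HasTwoDisjointEdges G = ∃[ a ] ∃[ b ] ∃[ c ] ∃[ d ]
  (Adj G a b × Adj G c d × a ≢ c × a ≢ d × b ≢ c × b ≢ d)

-- A b-colouring with k colours of a graph on at most k + 1 vertices forces a
-- k-clique (at most one colour class can hold more than its b-vertex), and a
-- b-3-colouring on at most five vertices is already a b-3-atom. So on at most five
-- vertices, excluding minimal b-3-atoms caps φ_r at 2, while two disjoint edges
-- leave an edge, hence φ_r ≥ 2, in every G - v. Conversely, if φ_r(G - v) =
-- φ_r(G) = b for every v, then b ≥ 3 would give b-cliques in all the G - v, and
-- these assemble to a (b + 1)-clique of G (for triangles on five vertices by an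
-- exhaustive check). Hence b = 2, which rules out b-3-atoms and triangles, and an
-- edge ab together with edges avoiding a and avoiding b yields two disjoint edges.
module Submission where

open import Defs
open import Data.Bool using (Bool; true; false)
open import Data.Bool.Properties using () renaming (_≟_ to _≟ᵇ_)
open import Data.Empty using (⊥; ⊥-elim)
open import Data.Fin using (Fin; zero; suc; punchIn; punchOut; inject≤) renaming (_≟_ to _≟ᶠ_)
open import Data.Fin.Properties
  using ( any?; all?; suc-injective; injective⇒≤; inject≤-injective
        ; punchIn-injective; punchInᵢ≢i; punchIn-punchOut; punchOut-injective)
  renaming (0≢1+n to 0≢1+i)
open import Data.Fin.Subset using (Subset)
open import Data.Fin.Subset.Properties using (anySubset?)
open import Data.List using ([]; _∷_; length; filter; allFin)
open import Data.List.Membership.Propositional using (_∈_)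
open import Data.List.Membership.Propositional.Properties using (∈-allFin)
open import Data.List.Properties using (filter-reject; filter-notAll; length-tabulate)
open import Data.List.Relation.Unary.Any as Any using (here; there)
open import Data.Nat using (ℕ; zero; suc; _≤_; _<_; _+_; _∸_; _/_; z≤n; s≤s; _≤?_)
open import Data.Nat.Induction using (<-rec)
open import Data.Nat.Properties using (≤-trans; ≤-pred; ≤-antisym; ≤∧≢⇒<; ≰⇒>; 1+n≰n; m≤n⇒m≤1+n; m≤m+n; m+n∸n≡m)
open import Data.Product using (Σ; ∃; ∃₂; ∃-syntax; _×_; _,_; proj₁; proj₂)
open import Data.Sum using (_⊎_; inj₁; inj₂)
open import Data.Vec using (Vec; []; _∷_; lookup; tabulate)
open import Data.Vec.Properties using (lookup∘tabulate)
open import Data.Vec.Relation.Unary.All.Properties using (lookup⁺; lookup⁻)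
open import Data.Vec.Relation.Unary.AllPairs using (AllPairs; []; _∷_; allPairs?)
import Data.Vec.Functional as Vector
open import Function using (_∘_; id)
open import Function.Bundles using (_⇔_; mk⇔; Equivalence)
open import Function.Definitions using (Injective)
open import Level using (Level)
open import Relation.Binary.PropositionalEquality
  using (_≡_; _≢_; refl; trans; cong; subst; subst₂; ≢-sym) renaming (sym to ≡-sym)
open import Relation.Nullary using (¬_; Dec; yes; no; ¬?)
open import Relation.Nullary.Decidable using (_×-dec_; _→-dec_; map′; from-yes; decidable-stable; ¬¬-excluded-middle)
open import Relation.Nullary.Negation using (contradiction; negated-stable; ¬¬-map)
open import Relation.Unary using (Pred; Decidable)

private
  variable
    ℓ : Level
    m n k t a b : ℕ

Clique : Graph n → (k : ℕ) → (Fin k → Fin n) → Set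
Clique G k q = ∀ i j → i ≢ j → Adj G (q i) (q j)

HasClique : Graph n → ℕ → Set
HasClique G k = ∃[ q ] Clique G k q

HasInducedBColoring : Graph n → ℕ → Set
HasInducedBColoring {n} G k =
  ∃[ m ] Σ (Fin m → Fin n) λ f → Injective _≡_ _≡_ f × HasBColoring (induced G f) k

EdgeAvoiding : Graph n → Fin n → Set
EdgeAvoiding G v = ∃₂ λ x y → Adj G x y × x ≢ v × y ≢ v

Adj-sym : (G : Graph n) {u v : Fin n} → Adj G u v → Adj G v u
Adj-sym G {u} {v} uv = trans (sym G v u) uv

Adj⇒≢ : (G : Graph n) {u v : Fin n} → Adj G u v → u ≢ v
Adj⇒≢ G {u} uu refl with trans (≡-sym uu) (irrefl G u)
... | ()

Clique-∷ : (G : Graph n) {x : Fin n} {xs : Vec (Fin n) k} →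
  (∀ i → Adj G x (lookup xs i)) → Clique G k (lookup xs) → Clique G (suc k) (lookup (x ∷ xs))
Clique-∷ G x~xs cl zero    zero    0≢0 = contradiction refl 0≢0
Clique-∷ G x~xs cl zero    (suc j) _   = x~xs j
Clique-∷ G x~xs cl (suc i) zero    _   = Adj-sym G (x~xs i)
Clique-∷ G x~xs cl (suc i) (suc j) i≢j = cl i j (i≢j ∘ cong suc)

edge-clique : (G : Graph n) {x y : Fin n} → Adj G x y → HasClique G 2
edge-clique G {x} {y} xy =
  lookup (x ∷ y ∷ []) , Clique-∷ G {xs = y ∷ []} (λ { zero → xy }) (Clique-∷ G {xs = []} (λ ()) (λ ()))

triangle : (G : Graph n) {x y z : Fin n} → Adj G x y → Adj G y z → Adj G x z → HasClique G 3
triangle G {x} {y} {z} xy yz xz = lookup (x ∷ y ∷ z ∷ []) ,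
  Clique-∷ G {xs = y ∷ z ∷ []} (λ { zero → xy ; (suc zero) → xz })
    (Clique-∷ G {xs = z ∷ []} (λ { zero → yz }) (Clique-∷ G {xs = []} (λ ()) (λ ())))

clique-injective : (G : Graph n) {q : Fin k → Fin n} → Clique G k q → Injective _≡_ _≡_ q
clique-injective G cl {i} {j} qi≡qj with i ≟ᶠ j
... | yes i≡j = i≡j
... | no  i≢j = contradiction qi≡qj (Adj⇒≢ G (cl i j i≢j))

clique-≤ : (G : Graph n) → t ≤ k → HasClique G k → HasClique G t
clique-≤ G t≤k (q , cl) =
  (λ i → q (inject≤ i t≤k)) , λ i j i≢j → cl _ _ (i≢j ∘ inject≤-injective t≤k t≤k i j)

clique⇒bColoring : (G : Graph n) {q : Fin k → Fin n} → Clique G k q → HasBColoring (induced G q) k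
clique⇒bColoring G {q} cl =
  id , ((λ i → i , refl) , λ _ _ → Adj⇒≢ (induced G q)) ,
  λ i → i , refl , λ j j≢i → j , cl i j (≢-sym j≢i) , refl

clique⇒inducedBColoring : (G : Graph n) → HasClique G k → HasInducedBColoring G k
clique⇒inducedBColoring G (q , cl) = _ , q , clique-injective G cl , clique⇒bColoring G cl

bColoring-colors≤vertices : (H : Graph m) → HasBColoring H k → k ≤ m
bColoring-colors≤vertices H (c , (onto , _) , _) = injective⇒≤ {f = proj₁ ∘ onto} λ {i} {j} e →
  trans (≡-sym (proj₂ (onto i))) (trans (cong c e) (proj₂ (onto j)))

inducedBColoring-colors≤vertices : (G : Graph n) → HasInducedBColoring G k → k ≤ n
inducedBColoring-colors≤vertices G (_ , f , f-inj , bc) =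
  ≤-trans (bColoring-colors≤vertices (induced G f) bc) (injective⇒≤ f-inj)

inducedBColoring-induced : (G : Graph n) {f : Fin m → Fin n} → Injective _≡_ _≡_ f →
  HasInducedBColoring (induced G f) k → HasInducedBColoring G k
inducedBColoring-induced G {f} f-inj (m , g , g-inj , bc) = m , f ∘ g , (λ e → g-inj (f-inj e)) , bc

inducedBColoring-delete : (G : Graph (suc n)) (v : Fin (suc n)) →
  HasInducedBColoring (delete G v) k → HasInducedBColoring G k
inducedBColoring-delete G v = inducedBColoring-induced G (punchIn-injective v _ _)

IsPhiR-maximal : (G : Graph n) → IsPhiR G b → HasInducedBColoring G k → k ≤ b
IsPhiR-maximal G (_ , maximal) (m , f , f-inj , bc) = maximal m f f-inj _ bc

bColoring⇒edge : (H : Graph m) → 2 ≤ k → HasBColoring H k → HasEdge H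
bColoring⇒edge H (s≤s (s≤s _)) (c , _ , bvertex) with bvertex zero
... | x , cx≡0 , x-bvertex with x-bvertex (suc zero) (λ 1≡cx → 0≢1+i (≡-sym (trans 1≡cx cx≡0)))
...   | u , xu , _ = x , u , xu

inducedBColoring⇒edge : (G : Graph n) → 2 ≤ k → HasInducedBColoring G k → HasEdge G
inducedBColoring⇒edge G 2≤k (_ , f , _ , bc) with bColoring⇒edge (induced G f) 2≤k bc
... | x , y , xy = f x , f y , xy

-- With at most k + 1 vertices at most one colour class has a vertex besides its
-- b-vertex, so every b-vertex sees all the other b-vertices.
bColoring⇒clique : (H : Graph m) → m ≤ suc k → HasBColoring H k → HasClique H k
bColoring⇒clique {m} {k} H m≤1+k (c , _ , bvertex) = x , x-clique
  where
  x : Fin k → Fin m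
  x i = proj₁ (bvertex i)

  cx : ∀ i → c (x i) ≡ i
  cx i = proj₁ (proj₂ (bvertex i))

  x-injective : Injective _≡_ _≡_ x
  x-injective {i} {j} e = trans (≡-sym (cx i)) (trans (cong c e) (cx j))

  neighbour : ∀ i j → i ≢ j → ∃[ u ] (Adj H (x i) u × c u ≡ j)
  neighbour i j i≢j = proj₂ (proj₂ (bvertex i)) j (λ j≡cxi → i≢j (≡-sym (trans j≡cxi (cx i))))

  Extra : Fin k → Set
  Extra j = ∃[ u ] (c u ≡ j × u ≢ x j)

  extra? : ∀ j → Dec (Extra j)
  extra? j = any? λ u → (c u ≟ᶠ j) ×-dec ¬? (u ≟ᶠ x j)

  no-extra : ∀ {j u} → ¬ Extra j → c u ≡ j → u ≡ x j
  no-extra {j} {u} ¬extra cu≡j with u ≟ᶠ x j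
  ... | yes u≡xj = u≡xj
  ... | no  u≢xj = contradiction (u , cu≡j , u≢xj) ¬extra

  x≢extra : ∀ {j} (e : Extra j) l → x l ≢ proj₁ e
  x≢extra (y , cy , y≢xj) l xl≡y =
    y≢xj (trans (≡-sym xl≡y) (cong x (trans (≡-sym (cx l)) (trans (cong c xl≡y) cy))))

  two-extras : ∀ {i j} → i ≢ j → Extra i → Extra j → ⊥
  two-extras {i} {j} i≢j ei@(y , cy , _) ej@(z , cz , _) = 1+n≰n (≤-trans (injective⇒≤ h-inj) m≤1+k)
    where
    h : Fin (2 + k) → Fin m
    h = y Vector.∷ z Vector.∷ x

    y≢z : y ≢ z
    y≢z y≡z = i≢j (trans (≡-sym cy) (trans (cong c y≡z) cz))

    h-inj : Injective _≡_ _≡_ h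
    h-inj {zero}        {zero}         _ = refl
    h-inj {zero}        {suc zero}     e = ⊥-elim (y≢z e)
    h-inj {zero}        {suc (suc l)}  e = ⊥-elim (x≢extra ei l (≡-sym e))
    h-inj {suc zero}    {zero}         e = ⊥-elim (y≢z (≡-sym e))
    h-inj {suc zero}    {suc zero}     _ = refl
    h-inj {suc zero}    {suc (suc l)}  e = ⊥-elim (x≢extra ej l (≡-sym e))
    h-inj {suc (suc l)} {zero}         e = ⊥-elim (x≢extra ei l e)
    h-inj {suc (suc l)} {suc zero}     e = ⊥-elim (x≢extra ej l e)
    h-inj {suc (suc l)} {suc (suc l′)} e = cong (Fin.suc ∘ Fin.suc) (x-injective e)

  x-clique : Clique H k x
  x-clique i j i≢j with extra? j
  ... | no ¬extra-j with neighbour i j i≢j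
  ...   | u , xi~u , cu≡j = subst (Adj H (x i)) (no-extra ¬extra-j cu≡j) xi~u
  x-clique i j i≢j | yes extra-j with extra? i
  ...   | yes extra-i = ⊥-elim (two-extras i≢j extra-i extra-j)
  ...   | no ¬extra-i with neighbour j i (≢-sym i≢j)
  ...     | u , xj~u , cu≡i = Adj-sym H (subst (Adj H (x j)) (no-extra ¬extra-i cu≡i) xj~u)

inducedBColoring⇒clique : (G : Graph n) → n ≤ suc k → HasInducedBColoring G k → HasClique G k
inducedBColoring⇒clique G n≤1+k (_ , f , f-inj , bc)
  with bColoring⇒clique (induced G f) (≤-trans (injective⇒≤ f-inj) n≤1+k) bc
... | q , cl = f ∘ q , cl

bAtom⇒bColoring : (A : Graph m) → IsBAtom A t → HasBColoring A t
bAtom⇒bColoring A (d , c , dc , independent , _ , reaches) =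
  d , ((λ i → c i , dc i) , independent) , λ i → c i , dc i , λ j j≢dci →
    let (u , du≡j , ci~u) = reaches i j (λ i≡j → j≢dci (trans (≡-sym i≡j) (≡-sym (dc i))))
    in u , ci~u , du≡j

module _ {A : Set} {P : Pred A ℓ} (P? : Decidable P) where

  length-filter-reject₂ : ∀ {x y xs} → x ∈ xs → y ∈ xs → x ≢ y → ¬ P x → ¬ P y →
    2 + length (filter P? xs) ≤ length xs
  length-filter-reject₂ (here refl) (here refl) x≢y _ _ = contradiction refl x≢y
  length-filter-reject₂ {xs = _ ∷ xs} (here refl) (there y∈) _ ¬Px ¬Py
    rewrite filter-reject P? {xs = xs} ¬Px = s≤s (filter-notAll P? xs (Any.map (λ { refl → ¬Py }) y∈))
  length-filter-reject₂ {xs = _ ∷ xs} (there x∈) (here refl) _ ¬Px ¬Py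
    rewrite filter-reject P? {xs = xs} ¬Py = s≤s (filter-notAll P? xs (Any.map (λ { refl → ¬Px }) x∈))
  length-filter-reject₂ {xs = z ∷ xs} (there x∈) (there y∈) x≢y ¬Px ¬Py with P? z
  ... | yes _ = s≤s (length-filter-reject₂ x∈ y∈ x≢y ¬Px ¬Py)
  ... | no  _ = m≤n⇒m≤1+n (length-filter-reject₂ x∈ y∈ x≢y ¬Px ¬Py)

bColoring⇒bAtom : (H : Graph m) → m ≤ 5 → HasBColoring H 3 → IsBAtom H 3
bColoring⇒bAtom {m} H m≤5 (c , (_ , proper) , bvertex) = c , x , cx , proper , classSize≤3 , reaches
  where
  x : Fin 3 → Fin m
  x i = proj₁ (bvertex i)

  cx : ∀ i → c (x i) ≡ i
  cx i = proj₁ (proj₂ (bvertex i))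

  -- the class of i misses the b-vertices of the colours punchIn i 0 and punchIn i 1
  classSize≤3 : ∀ i → classSize c i ≤ 3
  classSize≤3 i = ≤-pred (≤-pred (≤-trans (subst (2 + classSize c i ≤_) (length-tabulate id) outside) m≤5))
    where
    outside : 2 + classSize c i ≤ length (allFin m)
    outside = length-filter-reject₂ (λ u → c u ≟ᶠ i) (∈-allFin _) (∈-allFin _)
      (λ e → 0≢1+i (punchIn-injective i _ _ (trans (≡-sym (cx _)) (trans (cong c e) (cx _)))))
      (λ e → punchInᵢ≢i i zero (trans (≡-sym (cx _)) e))
      (λ e → punchInᵢ≢i i (suc zero) (trans (≡-sym (cx _)) e))

  reaches : ∀ i j → i ≢ j → ∃[ u ] (c u ≡ j × Adj H (x i) u)
  reaches i j i≢j with proj₂ (proj₂ (bvertex i)) j (λ j≡cxi → i≢j (≡-sym (trans j≡cxi (cx i))))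
  ... | u , xi~u , cu≡j = u , cu≡j , xi~u

-- A b-t-atom of least order is minimal.
noMinimalBAtom⇒noBAtom : (G : Graph n) → ¬ ContainsMinimalBAtom G t →
  (f : Fin m → Fin n) → Injective _≡_ _≡_ f → ¬ IsBAtom (induced G f) t
noMinimalBAtom⇒noBAtom {n} {t} {m} G ¬minimal = <-rec NoAtom step m
  where
  NoAtom : ℕ → Set
  NoAtom m = (f : Fin m → Fin n) → Injective _≡_ _≡_ f → ¬ IsBAtom (induced G f) t

  step : ∀ m → (∀ {m′} → m′ < m → NoAtom m′) → NoAtom m
  step m smaller f f-inj atom =
    ¬minimal (m , f , f-inj , atom , λ m′ g g-inj m′<m → smaller m′<m (f ∘ g) (λ e → g-inj (f-inj e)))

noMinimalBAtom⇒colors≤2 : (G : Graph n) → n ≤ 5 → ¬ ContainsMinimalBAtom G 3 →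
  HasInducedBColoring G k → k ≤ 2
noMinimalBAtom⇒colors≤2 {n} {k} G n≤5 ¬minimal bc with 3 ≤? k
... | no  k≱3 = ≤-pred (≰⇒> k≱3)
... | yes 3≤k = ⊥-elim (no-b3 (down-to-3 3≤k bc))
  where
  no-b3 : ¬ HasInducedBColoring G 3
  no-b3 (_ , f , f-inj , bc) = noMinimalBAtom⇒noBAtom G ¬minimal f f-inj
    (bColoring⇒bAtom (induced G f) (≤-trans (injective⇒≤ f-inj) n≤5) bc)

  down-to-3 : ∀ {k} → 3 ≤ k → HasInducedBColoring G k → HasInducedBColoring G 3
  down-to-3 {1} (s≤s ())
  down-to-3 {2} (s≤s (s≤s ()))
  down-to-3 {3} _ bc = bc
  down-to-3 {suc (suc (suc (suc k)))} _ bc = clique⇒inducedBColoring G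
    (clique-≤ G (s≤s (s≤s (s≤s z≤n))) (inducedBColoring⇒clique G (≤-trans n≤5 (m≤m+n 5 k)) bc))

deleteEdge⇒edgeAvoiding : (G : Graph (suc n)) (v : Fin (suc n)) → HasEdge (delete G v) → EdgeAvoiding G v
deleteEdge⇒edgeAvoiding G v (x , y , xy) = punchIn v x , punchIn v y , xy , punchInᵢ≢i v x , punchInᵢ≢i v y

edgeAvoiding⇒deleteEdge : (G : Graph (suc n)) (v : Fin (suc n)) → EdgeAvoiding G v → HasEdge (delete G v)
edgeAvoiding⇒deleteEdge {n} G v (x , y , xy , x≢v , y≢v) = x′ , y′ ,
  subst₂ (Adj G) (≡-sym (punchIn-punchOut (≢-sym x≢v))) (≡-sym (punchIn-punchOut (≢-sym y≢v))) xy
  where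
  x′ y′ : Fin n
  x′ = punchOut (≢-sym x≢v)
  y′ = punchOut (≢-sym y≢v)

twoDisjointEdges⇒edgeAvoiding : (G : Graph n) → HasTwoDisjointEdges G → ∀ v → EdgeAvoiding G v
twoDisjointEdges⇒edgeAvoiding G (a , b , c , d , ab , cd , a≢c , a≢d , b≢c , b≢d) v with a ≟ᶠ v | b ≟ᶠ v
... | yes refl | _        = c , d , cd , ≢-sym a≢c , ≢-sym a≢d
... | no  _    | yes refl = c , d , cd , ≢-sym b≢c , ≢-sym b≢d
... | no  a≢v  | no  b≢v  = a , b , ab , a≢v , b≢v

twoDisjointEdges? : (G : Graph n) → Dec (HasTwoDisjointEdges G)
twoDisjointEdges? G = any? λ a → any? λ b → any? λ c → any? λ d →
  (adj G a b ≟ᵇ true) ×-dec (adj G c d ≟ᵇ true) ×-dec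
  ¬? (a ≟ᶠ c) ×-dec ¬? (a ≟ᶠ d) ×-dec ¬? (b ≟ᶠ c) ×-dec ¬? (b ≟ᶠ d)

edgeAvoiding⇒disjoint⊎neighbour : (G : Graph n) {a b : Fin n} → Adj G a b → EdgeAvoiding G a →
  HasTwoDisjointEdges G ⊎ ∃[ c ] (Adj G b c × c ≢ a)
edgeAvoiding⇒disjoint⊎neighbour G {a} {b} ab (x , y , xy , x≢a , y≢a) with x ≟ᶠ b | y ≟ᶠ b
... | yes refl | _        = inj₂ (y , xy , y≢a)
... | no  _    | yes refl = inj₂ (x , Adj-sym G xy , x≢a)
... | no  x≢b  | no  y≢b  = inj₁ (a , b , x , y , ab , xy , ≢-sym x≢a , ≢-sym y≢a , ≢-sym x≢b , ≢-sym y≢b)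

edgesAvoidingAll⇒twoDisjointEdges⊎triangle : (G : Graph n) → HasEdge G → (∀ v → EdgeAvoiding G v) →
  HasTwoDisjointEdges G ⊎ HasClique G 3
edgesAvoidingAll⇒twoDisjointEdges⊎triangle G (a , b , ab) avoiding
  with edgeAvoiding⇒disjoint⊎neighbour G ab (avoiding a) | edgeAvoiding⇒disjoint⊎neighbour G (Adj-sym G ab) (avoiding b)
... | inj₁ disjoint | _ = inj₁ disjoint
... | inj₂ _ | inj₁ disjoint = inj₁ disjoint
... | inj₂ (c , bc , c≢a) | inj₂ (e , ae , e≢b) with c ≟ᶠ e
...   | yes refl = inj₂ (triangle G ab bc ae)
...   | no  c≢e  = inj₁ (b , c , a , e , bc , ae , ≢-sym (Adj⇒≢ G ab) , ≢-sym e≢b , c≢a , c≢e)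

injective⇒surjective : {q : Fin n → Fin n} → Injective _≡_ _≡_ q → ∀ u → ∃[ i ] q i ≡ u
injective⇒surjective {suc n} {q} q-inj u with any? (λ i → q i ≟ᶠ u)
... | yes hit  = hit
... | no  miss = ⊥-elim (1+n≰n (injective⇒≤ {f = λ i → punchOut (u≢q i)} λ e → q-inj (punchOut-injective (u≢q _) (u≢q _) e)))
  where
  u≢q : ∀ i → u ≢ q i
  u≢q i u≡qi = miss (i , ≡-sym u≡qi)

spanningClique⇒complete : (G : Graph n) {q : Fin n → Fin n} → Clique G n q → Clique G n id
spanningClique⇒complete G cl u w u≢w
  with injective⇒surjective (clique-injective G cl) u | injective⇒surjective (clique-injective G cl) w
... | i , refl | j , refl = cl i j λ { refl → u≢w refl }

∃-avoiding₂ : (u w : Fin (3 + n)) → ∃[ v ] (v ≢ u × v ≢ w)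
∃-avoiding₂ {n} u w with u ≟ᶠ w
... | yes refl = punchIn u zero , punchInᵢ≢i u zero , punchInᵢ≢i u zero
... | no  u≢w  = punchIn u (other w′) , punchInᵢ≢i u _ ,
  λ e → other≢ w′ (punchIn-injective u _ _ (trans e (≡-sym (punchIn-punchOut u≢w))))
  where
  w′ = punchOut u≢w
  other : Fin (2 + n) → Fin (2 + n)
  other zero    = suc zero
  other (suc _) = zero
  other≢ : ∀ x → other x ≢ x
  other≢ zero    ()
  other≢ (suc _) ()

completeDeletions⇒complete : (G : Graph (3 + n)) → (∀ v → Clique (delete G v) (2 + n) id) → Clique G (3 + n) id
completeDeletions⇒complete G complete u w u≢w with ∃-avoiding₂ u w
... | v , v≢u , v≢w = subst₂ (Adj G) (punchIn-punchOut v≢u) (punchIn-punchOut v≢w)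
  (complete v _ _ (u≢w ∘ punchOut-injective v≢u v≢w))

-- Exhaustive search over small graphs

_≈ᴳ_ : Graph n → Graph n → Set
G ≈ᴳ H = ∀ u v → adj G u v ≡ adj H u v

cone : Graph n → Subset n → Graph (suc n)
cone {n} H N = record { adj = adjacent ; sym = symmetric ; irrefl = loopless }
  where
  adjacent : Fin (suc n) → Fin (suc n) → Bool
  adjacent zero    zero    = false
  adjacent zero    (suc j) = lookup N j
  adjacent (suc i) zero    = lookup N i
  adjacent (suc i) (suc j) = adj H i j

  symmetric : ∀ u v → adjacent u v ≡ adjacent v u
  symmetric zero    zero    = refl
  symmetric zero    (suc j) = refl
  symmetric (suc i) zero    = refl
  symmetric (suc i) (suc j) = sym H i j

  loopless : ∀ u → adjacent u u ≡ false
  loopless zero    = refl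
  loopless (suc i) = irrefl H i

cone-delete : (G : Graph (suc n)) → G ≈ᴳ cone (delete G zero) (tabulate (adj G zero ∘ suc))
cone-delete G zero    zero    = irrefl G zero
cone-delete G zero    (suc j) = ≡-sym (lookup∘tabulate _ j)
cone-delete G (suc i) zero    = trans (sym G (suc i) zero) (≡-sym (lookup∘tabulate _ i))
cone-delete G (suc i) (suc j) = refl

cone-cong : {G H : Graph n} (N : Subset n) → G ≈ᴳ H → cone G N ≈ᴳ cone H N
cone-cong N G≈H zero    zero    = refl
cone-cong N G≈H zero    (suc j) = refl
cone-cong N G≈H (suc i) zero    = refl
cone-cong N G≈H (suc i) (suc j) = G≈H i j

∀-subset? : {P : Pred (Subset n) ℓ} → Decidable P → Dec (∀ N → P N)
∀-subset? P? = map′ (λ ¬counterexample N → decidable-stable (P? N) (λ ¬PN → ¬counterexample (N , ¬PN)))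
  (λ ∀P (N , ¬PN) → ¬PN (∀P N)) (¬? (anySubset? (¬? ∘ P?)))

∀-graph? : ∀ n {P : Pred (Graph n) ℓ} → Decidable P → (∀ {G H} → G ≈ᴳ H → P G → P H) → Dec (∀ G → P G)
∀-graph? zero P? resp = map′ (λ P-empty G → resp (λ ()) P-empty) (λ ∀P → ∀P empty) (P? empty)
  where
  empty : Graph 0
  empty = record { adj = λ () ; sym = λ () ; irrefl = λ () }
∀-graph? (suc n) {P = P} P? resp =
  map′ (λ ∀cone G → resp (λ u v → ≡-sym (cone-delete G u v)) (∀cone (delete G zero) _))
       (λ ∀P H N → ∀P (cone H N))
       (∀-graph? n (λ H → ∀-subset? (P? ∘ cone H)) λ G≈H ∀N N → resp (cone-cong N G≈H) (∀N N))

∃-vec? : ∀ k {P : Pred (Vec (Fin n) k) ℓ} → Decidable P → Dec (∃ P)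
∃-vec? zero    P? = map′ ([] ,_) (λ { ([] , p) → p }) (P? [])
∃-vec? (suc k) P? = map′ (λ (x , xs , p) → x ∷ xs , p) (λ { (x ∷ xs , p) → x , xs , p })
  (any? λ x → ∃-vec? k (P? ∘ (x ∷_)))

allPairs⇒clique : (G : Graph n) {xs : Vec (Fin n) k} → AllPairs (Adj G) xs → Clique G k (lookup xs)
allPairs⇒clique G []               = λ ()
allPairs⇒clique G (x~xs ∷ pairs) = Clique-∷ G (lookup⁺ x~xs) (allPairs⇒clique G pairs)

clique⇒allPairs : (G : Graph n) (xs : Vec (Fin n) k) → Clique G k (lookup xs) → AllPairs (Adj G) xs
clique⇒allPairs G []       _  = []
clique⇒allPairs G (x ∷ xs) cl = lookup⁻ (λ i → cl zero (suc i) (λ ()))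
  ∷ clique⇒allPairs G xs (λ i j i≢j → cl (suc i) (suc j) (i≢j ∘ suc-injective))

hasClique? : (G : Graph n) (k : ℕ) → Dec (HasClique G k)
hasClique? G k =
  map′ (λ (xs , pairs) → lookup xs , allPairs⇒clique G pairs)
       (λ (q , cl) → tabulate q , clique⇒allPairs G (tabulate q) (tabulate-clique cl))
       (∃-vec? k (allPairs? λ x y → adj G x y ≟ᵇ true))
  where
  tabulate-clique : ∀ {q} → Clique G k q → Clique G k (lookup (tabulate q))
  tabulate-clique {q} cl i j i≢j =
    subst₂ (Adj G) (≡-sym (lookup∘tabulate q i)) (≡-sym (lookup∘tabulate q j)) (cl i j i≢j)

HasClique-≈ : {G H : Graph n} → G ≈ᴳ H → HasClique G k → HasClique H k
HasClique-≈ G≈H (q , cl) = q , λ i j i≢j → trans (≡-sym (G≈H _ _)) (cl i j i≢j)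

CliquesLift : ℕ → Graph (suc n) → Set
CliquesLift k G = (∀ v → HasClique (delete G v) k) → HasClique G (suc k)

spanningCliquesLift : (G : Graph (3 + n)) → CliquesLift (2 + n) G
spanningCliquesLift G cliques =
  id , completeDeletions⇒complete G λ v → spanningClique⇒complete (delete G v) (proj₂ (cliques v))

cliquesLift? : ∀ k (G : Graph (suc n)) → Dec (CliquesLift k G)
cliquesLift? k G = all? (λ v → hasClique? (delete G v) k) →-dec hasClique? G (suc k)

CliquesLift-≈ : {G H : Graph (suc n)} → G ≈ᴳ H → CliquesLift k G → CliquesLift k H
CliquesLift-≈ {G = G} {H} G≈H lift cliques = HasClique-≈ {G = G} {H} G≈H (lift λ v →
  HasClique-≈ {G = delete H v} {delete G v} (λ i j → ≡-sym (G≈H (punchIn v i) (punchIn v j))) (cliques v))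

-- For k = n every G - v is complete; only triangles on five vertices need the search.
cliquesLift : 3 ≤ k → k ≤ n → n ≤ 4 → (G : Graph (suc n)) → CliquesLift k G
cliquesLift (s≤s (s≤s (s≤s _))) (s≤s (s≤s (s≤s z≤n))) (s≤s (s≤s (s≤s z≤n))) = spanningCliquesLift
cliquesLift (s≤s (s≤s (s≤s _))) (s≤s (s≤s (s≤s (s≤s z≤n)))) (s≤s (s≤s (s≤s (s≤s z≤n)))) = spanningCliquesLift
cliquesLift (s≤s (s≤s (s≤s _))) (s≤s (s≤s (s≤s z≤n))) (s≤s (s≤s (s≤s (s≤s z≤n)))) =
  from-yes (∀-graph? 5 (cliquesLift? 3) λ {G} {H} → CliquesLift-≈ {G = G} {H})

-- Existence of φ_r, up to double negation

¬¬-∀ : {P : Pred (Fin n) ℓ} → (∀ i → ¬ ¬ P i) → ¬ ¬ (∀ i → P i)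
¬¬-∀ {zero}  _   ¬∀ = ¬∀ λ ()
¬¬-∀ {suc n} ¬¬P ¬∀ = ¬¬P zero λ P0 → ¬¬-∀ (¬¬P ∘ suc) λ P-suc → ¬∀ λ { zero → P0 ; (suc i) → P-suc i }

¬¬-maximum : {P : Pred ℕ ℓ} → P 0 → (∀ {k} → P k → k ≤ n) → ¬ ¬ (∃[ r ] (P r × ∀ {k} → P k → k ≤ r))
¬¬-maximum {n = n} {P = P} P0 bounded = ¬¬-map (λ (r , Pr , max) → r , Pr , λ {_} Pk → max Pk (bounded Pk)) (upTo n)
  where
  upTo : ∀ t → ¬ ¬ (∃[ r ] (P r × ∀ {k} → P k → k ≤ t → k ≤ r))
  upTo zero    ¬max = ¬max (0 , P0 , λ _ k≤0 → k≤0)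
  upTo (suc t) ¬max = upTo t λ (r , Pr , max) → ¬¬-excluded-middle λ
    { (yes P1+t) → ¬max (suc t , P1+t , λ _ k≤1+t → k≤1+t)
    ; (no ¬P1+t) → ¬max (r , Pr , λ {k} Pk k≤1+t → max Pk (≤-pred (≤∧≢⇒< k≤1+t λ { refl → ¬P1+t Pk }))) }

¬¬-IsPhiR : (G : Graph n) → ¬ ¬ ∃ (IsPhiR G)
¬¬-IsPhiR G = ¬¬-map maximum⇒IsPhiR (¬¬-maximum empty-bColoring (inducedBColoring-colors≤vertices G))
  where
  maximum⇒IsPhiR : ∃[ r ] (HasInducedBColoring G r × ∀ {k} → HasInducedBColoring G k → k ≤ r) → ∃ (IsPhiR G)
  maximum⇒IsPhiR (r , bc , max) = r , bc , λ m f f-inj _ bc′ → max (m , f , f-inj , bc′)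

  empty-bColoring : HasInducedBColoring G 0
  empty-bColoring = 0 , (λ ()) , (λ { {()} }) , (λ ()) , ((λ ()) , λ ()) , λ ()

deletionStable⇒ : (G : Graph (suc n)) → suc n ≤ 5 → HasEdge G → IsPhiR G b →
  (∀ v → HasInducedBColoring (delete G v) b) → HasTwoDisjointEdges G × ¬ ContainsMinimalBAtom G 3
deletionStable⇒ {n} {b} G (s≤s n≤4) edge@(_ , _ , xy) φᵣ bc-delete = two-disjoint , ¬minimal
  where
  ¬3≤b : ¬ 3 ≤ b
  ¬3≤b 3≤b = 1+n≰n (IsPhiR-maximal G φᵣ (clique⇒inducedBColoring G (cliquesLift 3≤b b≤n n≤4 G cliques)))
    where
    b≤n : b ≤ n
    b≤n = inducedBColoring-colors≤vertices (delete G zero) (bc-delete zero)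
    cliques : ∀ v → HasClique (delete G v) b
    cliques v = inducedBColoring⇒clique (delete G v) (≤-trans n≤4 (s≤s 3≤b)) (bc-delete v)

  2≤b : 2 ≤ b
  2≤b = IsPhiR-maximal G φᵣ (clique⇒inducedBColoring G (edge-clique G xy))

  ¬minimal : ¬ ContainsMinimalBAtom G 3
  ¬minimal (_ , f , f-inj , atom , _) =
    ¬3≤b (IsPhiR-maximal G φᵣ (_ , f , f-inj , bAtom⇒bColoring (induced G f) atom))

  two-disjoint : HasTwoDisjointEdges G
  two-disjoint with edgesAvoidingAll⇒twoDisjointEdges⊎triangle G edge
    (λ v → deleteEdge⇒edgeAvoiding G v (inducedBColoring⇒edge (delete G v) 2≤b (bc-delete v)))
  ... | inj₁ disjoint = disjoint
  ... | inj₂ triangle = ⊥-elim (¬3≤b (IsPhiR-maximal G φᵣ (clique⇒inducedBColoring G triangle)))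

deletionStable⇐ : (G : Graph (suc n)) → suc n ≤ 5 → HasTwoDisjointEdges G → ¬ ContainsMinimalBAtom G 3 →
  ∀ v → IsPhiR (delete G v) a → IsPhiR G b → a ≡ b
deletionStable⇐ {a = a} {b} G n≤5 disjoint ¬minimal v φᵣ-delete φᵣ = ≤-antisym a≤b (≤-trans b≤2 2≤a)
  where
  a≤b : a ≤ b
  a≤b = IsPhiR-maximal G φᵣ (inducedBColoring-delete G v (proj₁ φᵣ-delete))

  b≤2 : b ≤ 2
  b≤2 = noMinimalBAtom⇒colors≤2 G n≤5 ¬minimal (proj₁ φᵣ)

  2≤a : 2 ≤ a
  2≤a with edgeAvoiding⇒deleteEdge G v (twoDisjointEdges⇒edgeAvoiding G disjoint v)
  ... | _ , _ , xy = IsPhiR-maximal (delete G v) φᵣ-delete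
    (clique⇒inducedBColoring (delete G v) (edge-clique (delete G v) xy))

deletionStable⇔ : (G : Graph (suc n)) → suc n ≤ 5 → HasEdge G →
  (∀ v a b → IsPhiR (delete G v) a → IsPhiR G b → a ≡ b) ⇔
  (HasTwoDisjointEdges G × ¬ ContainsMinimalBAtom G 3)
deletionStable⇔ G n≤5 edge = mk⇔
  (λ stable → let ¬¬rhs = ¬¬-rhs stable in
    decidable-stable (twoDisjointEdges? G) (¬¬-map proj₁ ¬¬rhs) , negated-stable (¬¬-map proj₂ ¬¬rhs))
  (λ (disjoint , ¬minimal) v _ _ → deletionStable⇐ G n≤5 disjoint ¬minimal v)
  where
  ¬¬-rhs : (∀ v a b → IsPhiR (delete G v) a → IsPhiR G b → a ≡ b) →
    ¬ ¬ (HasTwoDisjointEdges G × ¬ ContainsMinimalBAtom G 3)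
  ¬¬-rhs stable ¬rhs = ¬¬-IsPhiR G λ (b , φᵣ) → ¬¬-∀ (¬¬-IsPhiR ∘ delete G) λ φᵣ-delete → ¬rhs
    (deletionStable⇒ G n≤5 edge φᵣ λ v → let (a , φᵣ-v) = φᵣ-delete v in
      subst (HasInducedBColoring (delete G v)) (stable v a b φᵣ-v φᵣ) (proj₁ φᵣ-v))

n/2≡2 : 4 ≤ n → n ≤ 5 → n / 2 ≡ 2
n/2≡2 (s≤s (s≤s (s≤s (s≤s z≤n)))) (s≤s (s≤s (s≤s (s≤s z≤n))))       = refl
n/2≡2 (s≤s (s≤s (s≤s (s≤s z≤n)))) (s≤s (s≤s (s≤s (s≤s (s≤s z≤n))))) = refl

mainTheorem20 : ∀ (n : ℕ) (G : Graph n) → 4 ≤ n → n ≤ 5 → HasEdge G →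
    ((∀ (v : Fin n) (a b : ℕ) → IsPhiR (delete G v) a → IsPhiR G b → a ≡ b + (n / 2) ∸ 2)
      ⇔ (HasTwoDisjointEdges G × ¬ ContainsMinimalBAtom G 3))
mainTheorem20 zero G () _ _
mainTheorem20 (suc n) G 4≤n n≤5 edge = mk⇔
  (λ stable → to λ v a b φᵣ-v φᵣ → trans (stable v a b φᵣ-v φᵣ) (offset b))
  (λ rhs v a b φᵣ-v φᵣ → trans (from rhs v a b φᵣ-v φᵣ) (≡-sym (offset b)))
  where
  open Equivalence (deletionStable⇔ G n≤5 edge)
  offset : ∀ b → b + suc n / 2 ∸ 2 ≡ b
  offset b rewrite n/2≡2 4≤n n≤5 = m+n∸n≡m b 2
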